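{- In any candy-passing game (with any number $c>0$ of candies among $n>2$ students), after a finite number of rounds the set of students having at least four candies is fixed (it no longer changes in any later round), and each such student's number of candies no longer changes in any later round.
   Context: The candy-passing game: $c>0$ candies are distributed arbitrarily among $n>2$ students sitting in a circle. At each round, simultaneously, every student who has two or more candies passes one candy to his left-hand neighbor and one candy to his right-hand neighbor; a student with fewer than two candies does nothing. A student whose pile has four or more candies is said to have an abundant candy pile. -}

module Defs where

open import Data.Nat using (ℕ; zero; suc; _+_; _∸_; _≤_; _≤ᵇ_)
open import Data.Nat.DivMod using (_mod_)
open import Data.Fin using (Fin; toℕ)
open import Data.Bool using (if_then_else_)
open import Data.List using (map; allFin)
open import Data.Nat.ListAction using (sum)

Config : ℕ → Set
Config n = Fin n → ℕ

-- Neighbours on the circle: student i+1 and i-1 (mod n).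
-- (Which one is called "left" is irrelevant, since the rule is symmetric.)
right : ∀ {n} → Fin n → Fin n
right {suc m} i = (suc (toℕ i)) mod (suc m)

left : ∀ {n} → Fin n → Fin n
left {suc m} i = (toℕ i + m) mod (suc m)

gives : ℕ → ℕ
gives k = if 2 ≤ᵇ k then 1 else 0

step : ∀ {n} → Config n → Config n
step x i = (x i ∸ (gives (x i) + gives (x i))) + gives (x (left i)) + gives (x (right i))

iterate : ∀ {n} → ℕ → Config n → Config n
iterate zero    x = x
iterate (suc t) x = step (iterate t x)

total : ∀ {n} → Config n → ℕ
total {n} x = sum (map x (allFin n))

Abundant : ℕ → Set
Abundant k = 4 ≤ k

module Submission where

open import Defs
open import Data.Nat using (ℕ; zero; suc; _<_; _≤_; _≤′_; ≤′-refl; ≤′-step; _+_; _*_; _∸_; _^_; _⊔_; z≤n; s≤s)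
open import Data.Nat.Properties
open import Data.Nat.ListAction using (sum)
open import Data.Fin using (Fin; toℕ; fromℕ<; funToFin; finToFun)
open import Data.Fin.Properties using (pigeonhole; finToFun-funToFin; toℕ-fromℕ<)
open import Data.List using (List; _∷_)
open import Data.List.Relation.Unary.Any using (here; there)
open import Data.List.Membership.Propositional using (_∈_)
open import Data.List.Membership.Propositional.Properties using (∈-map⁺; ∈-allFin)
open import Data.Product using (∃-syntax; ∃₂; _×_; _,_)
open import Function.Bundles using (_⇔_; mk⇔)
open import Relation.Binary.PropositionalEquality

-- Every pile is bounded by the total number of candies (or by 3),
-- so the game visits only finitely many configurations and is eventually
-- periodic. The abundant part of a pile (the pile itself if it has at least
-- four candies, 0 otherwise) never increases: a pile with at least two
-- candies loses two and gains at most two, a smaller pile grows to at most 3.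
-- A non-increasing quantity along a periodic orbit is constant.

∈⇒≤sum : ∀ {m} {ms : List ℕ} → m ∈ ms → m ≤ sum ms
∈⇒≤sum {ms = _ ∷ ms} (here refl) = m≤m+n _ (sum ms)
∈⇒≤sum {ms = m′ ∷ _} (there m∈ms) = ≤-trans (∈⇒≤sum m∈ms) (m≤n+m _ m′)

pile≤total : ∀ {n} (x : Config n) i → x i ≤ total x
pile≤total {n} x i = ∈⇒≤sum (∈-map⁺ x (∈-allFin {n} i))

gives≤1 : ∀ k → gives k ≤ 1
gives≤1 zero          = z≤n
gives≤1 (suc zero)    = z≤n
gives≤1 (suc (suc k)) = ≤-refl

step≤pile⊔3 : ∀ {n} (y : Config n) i → step y i ≤ y i ⊔ 3
step≤pile⊔3 y i = passing (y i) (gives≤1 (y (left i))) (gives≤1 (y (right i)))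
  where
  passing : ∀ k {a b} → a ≤ 1 → b ≤ 1 → k ∸ (gives k + gives k) + a + b ≤ k ⊔ 3
  passing zero          a≤1 b≤1 = ≤-trans (+-mono-≤ a≤1 b≤1) (n≤1+n 2)
  passing (suc zero)    a≤1 b≤1 = s≤s (+-mono-≤ a≤1 b≤1)
  passing (suc (suc m)) {a} {b} a≤1 b≤1 = begin
    m + a + b         ≡⟨ +-assoc m a b ⟩
    m + (a + b)       ≤⟨ +-monoʳ-≤ m (+-mono-≤ a≤1 b≤1) ⟩
    m + 2             ≡⟨ +-comm m 2 ⟩
    suc (suc m)       ≤⟨ m≤m⊔n (suc (suc m)) 3 ⟩
    suc (suc m) ⊔ 3   ∎
    where open ≤-Reasoning

iterate-≤ : ∀ {n} {M} → 3 ≤ M → (x : Config n) → (∀ i → x i ≤ M) → ∀ t i → iterate t x i ≤ M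
iterate-≤ 3≤M x x≤M zero    i = x≤M i
iterate-≤ 3≤M x x≤M (suc t) i =
  ≤-trans (step≤pile⊔3 (iterate t x) i) (⊔-lub (iterate-≤ 3≤M x x≤M t i) 3≤M)

iterate-≤-total⊔3 : ∀ {n} (x : Config n) t i → iterate t x i ≤ total x ⊔ 3
iterate-≤-total⊔3 x = iterate-≤ (m≤n⊔m (total x) 3) x (λ i → m≤n⇒m≤n⊔o 3 (pile≤total x i))

encode : ∀ {n M} (y : Config n) → (∀ i → y i ≤ M) → Fin (suc M ^ n)
encode y y≤M = funToFin (λ i → fromℕ< (s≤s (y≤M i)))

encode-injective : ∀ {n M} {y z : Config n} (y≤M : ∀ i → y i ≤ M) (z≤M : ∀ i → z i ≤ M) →
  encode y y≤M ≡ encode z z≤M → y ≗ z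
encode-injective {y = y} {z} y≤M z≤M eq i = begin
  y i                                       ≡⟨ toℕ-fromℕ< _ ⟨
  toℕ (fromℕ< (s≤s (y≤M i)))                ≡⟨ cong toℕ (finToFun-funToFin _ i) ⟨
  toℕ (finToFun (encode y y≤M) i)           ≡⟨ cong (λ c → toℕ (finToFun c i)) eq ⟩
  toℕ (finToFun (encode z z≤M) i)           ≡⟨ cong toℕ (finToFun-funToFin _ i) ⟩
  toℕ (fromℕ< (s≤s (z≤M i)))                ≡⟨ toℕ-fromℕ< _ ⟩
  z i                                       ∎
  where open ≡-Reasoning

bounded-sequence-repeats : ∀ {n M} (f : ℕ → Config n) → (∀ t i → f t i ≤ M) →
  ∃₂ λ p q → p < q × f q ≗ f p
bounded-sequence-repeats {n} {M} f f≤M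
  with p , q , p<q , eq ← pigeonhole (n<1+n (suc M ^ n)) (λ t → encode (f (toℕ t)) (f≤M (toℕ t)))
  = toℕ p , toℕ q , p<q , encode-injective (f≤M (toℕ q)) (f≤M (toℕ p)) (sym eq)

step-cong : ∀ {n} {y z : Config n} → y ≗ z → step y ≗ step z
step-cong {y = y} {z} y≗z i rewrite y≗z i | y≗z (left i) | y≗z (right i) = refl

iterate-cong : ∀ {n} t {y z : Config n} → y ≗ z → iterate t y ≗ iterate t z
iterate-cong zero    y≗z = y≗z
iterate-cong (suc t) y≗z = step-cong (iterate-cong t y≗z)

iterate-+ : ∀ {n} s t (x : Config n) → iterate (s + t) x ≡ iterate s (iterate t x)
iterate-+ zero    t x = refl
iterate-+ (suc s) t x = cong step (iterate-+ s t x)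

iterate-periodic : ∀ {n} d p (x : Config n) → iterate (d + p) x ≗ iterate p x →
  ∀ k → iterate (k * d + p) x ≗ iterate p x
iterate-periodic d p x period zero    i = refl
iterate-periodic d p x period (suc k) i = begin
  iterate (d + k * d + p) x i           ≡⟨ cong (λ s → iterate s x i) (+-assoc d (k * d) p) ⟩
  iterate (d + (k * d + p)) x i         ≡⟨ cong (λ c → c i) (iterate-+ d (k * d + p) x) ⟩
  iterate d (iterate (k * d + p) x) i   ≡⟨ iterate-cong d (iterate-periodic d p x period k) i ⟩
  iterate d (iterate p x) i             ≡⟨ cong (λ c → c i) (iterate-+ d p x) ⟨
  iterate (d + p) x i                   ≡⟨ period i ⟩
  iterate p x i                         ∎
  where open ≡-Reasoning

eventually-returns : ∀ {n} (x : Config n) → ∃[ p ] ∀ t → p ≤ t → ∃[ s ] t ≤ s × iterate s x ≗ iterate p x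
eventually-returns x
  with p , q , p<q , eq ← bounded-sequence-repeats (λ t → iterate t x) (iterate-≤-total⊔3 x)
  = p , λ t _ → t * d + p , t≤t*d+p t , iterate-periodic d p x period t
  where
  d : ℕ
  d = q ∸ p
  period : iterate (d + p) x ≗ iterate p x
  period rewrite m∸n+n≡m (<⇒≤ p<q) = eq
  t≤t*d+p : ∀ t → t ≤ t * d + p
  t≤t*d+p t = begin
    t          ≡⟨ *-identityʳ t ⟨
    t * 1      ≤⟨ *-monoʳ-≤ t (m<n⇒0<n∸m p<q) ⟩
    t * d      ≤⟨ m≤m+n (t * d) p ⟩
    t * d + p  ∎
    where open ≤-Reasoning

abundantPart : ℕ → ℕ
abundantPart k@(suc (suc (suc (suc _)))) = k
abundantPart _                           = 0

abundantPart-mono-≤ : ∀ {k l} → k ≤ l → abundantPart k ≤ abundantPart l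
abundantPart-mono-≤ {zero}                      _ = z≤n
abundantPart-mono-≤ {suc zero}                  _ = z≤n
abundantPart-mono-≤ {suc (suc zero)}            _ = z≤n
abundantPart-mono-≤ {suc (suc (suc zero))}      _ = z≤n
abundantPart-mono-≤ {suc (suc (suc (suc _)))} k≤l@(s≤s (s≤s (s≤s (s≤s _)))) = k≤l

abundantPart-⊔3 : ∀ k → abundantPart (k ⊔ 3) ≡ abundantPart k
abundantPart-⊔3 zero                      = refl
abundantPart-⊔3 (suc zero)                = refl
abundantPart-⊔3 (suc (suc zero))          = refl
abundantPart-⊔3 (suc (suc (suc zero)))    = refl
abundantPart-⊔3 (suc (suc (suc (suc k)))) = refl

abundantPart-abundant : ∀ {k} → Abundant k → abundantPart k ≡ k
abundantPart-abundant (s≤s (s≤s (s≤s (s≤s _)))) = refl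

abundantPart-reflects-Abundant : ∀ {k} → Abundant (abundantPart k) → Abundant k
abundantPart-reflects-Abundant {suc (suc (suc (suc _)))} 4≤k = 4≤k

abundantPart-step : ∀ {n} (y : Config n) i → abundantPart (step y i) ≤ abundantPart (y i)
abundantPart-step y i = begin
  abundantPart (step y i)     ≤⟨ abundantPart-mono-≤ (step≤pile⊔3 y i) ⟩
  abundantPart (y i ⊔ 3)      ≡⟨ abundantPart-⊔3 (y i) ⟩
  abundantPart (y i)          ∎
  where open ≤-Reasoning

abundantPart-iterate-antitone : ∀ {n} (x : Config n) {s t} → s ≤ t → ∀ i →
  abundantPart (iterate t x i) ≤ abundantPart (iterate s x i)
abundantPart-iterate-antitone x s≤t i = go (≤⇒≤′ s≤t)
  where
  go : ∀ {s t} → s ≤′ t → abundantPart (iterate t x i) ≤ abundantPart (iterate s x i)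
  go ≤′-refl                    = ≤-refl
  go {t = suc t} (≤′-step s≤′t) = ≤-trans (abundantPart-step (iterate t x) i) (go s≤′t)

abundantPart-≡⇒≡ : ∀ {a b} → abundantPart a ≡ abundantPart b → Abundant b → a ≡ b
abundantPart-≡⇒≡ {a} {b} eq 4≤b = begin
  a               ≡⟨ abundantPart-abundant 4≤a ⟨
  abundantPart a  ≡⟨ eq ⟩
  abundantPart b  ≡⟨ abundantPart-abundant 4≤b ⟩
  b               ∎
  where
  open ≡-Reasoning
  4≤a : Abundant a
  4≤a = abundantPart-reflects-Abundant (subst Abundant (sym (trans eq (abundantPart-abundant 4≤b))) 4≤b)

abundantPart-≡⇒same-abundance : ∀ {a b} → abundantPart a ≡ abundantPart b →
  (Abundant a ⇔ Abundant b) × (Abundant b → a ≡ b)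
abundantPart-≡⇒same-abundance eq =
  mk⇔ (λ 4≤a → subst Abundant (sym (abundantPart-≡⇒≡ (sym eq) 4≤a)) 4≤a)
      (λ 4≤b → subst Abundant (sym (abundantPart-≡⇒≡ eq 4≤b)) 4≤b)
  , abundantPart-≡⇒≡ eq

abundantPart-eventually-constant : ∀ {n} (x : Config n) →
  ∃[ p ] ∀ t → p ≤ t → ∀ i → abundantPart (iterate t x i) ≡ abundantPart (iterate p x i)
abundantPart-eventually-constant x with p , returns ← eventually-returns x = p , constant
  where
  constant : ∀ t → p ≤ t → ∀ i → abundantPart (iterate t x i) ≡ abundantPart (iterate p x i)
  constant t p≤t i with s , t≤s , xs≗xp ← returns t p≤t = ≤-antisym
    (abundantPart-iterate-antitone x p≤t i)
    (begin
      abundantPart (iterate p x i)  ≡⟨ cong abundantPart (xs≗xp i) ⟨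
      abundantPart (iterate s x i)  ≤⟨ abundantPart-iterate-antitone x t≤s i ⟩
      abundantPart (iterate t x i)  ∎)
    where open ≤-Reasoning

lemma1 : (n : ℕ) → 2 < n → (x : Config n) → 0 < total x →
    ∃[ T ] ((t : ℕ) → T ≤ t → (i : Fin n) →
      (Abundant (iterate t x i) ⇔ Abundant (iterate T x i))
      × (Abundant (iterate T x i) → iterate t x i ≡ iterate T x i))
lemma1 n _ x _ with T , constant ← abundantPart-eventually-constant x =
  T , λ t T≤t i → abundantPart-≡⇒same-abundance (constant t T≤t i)
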